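{- For every positive integer $n$, the integer $\{2\}$-domination number of the grid graph $G_{2,n}$ is $$\gamma_{\{2\}}(G_{2,n}) = n+1.$$
   Context: For positive integers $m,n$, the grid graph $G_{m,n}=P_m\square P_n$ has vertex set $\{v_{i,j}: 1\le i\le m,\ 1\le j\le n\}$, where $v_{i_1,j_1}v_{i_2,j_2}$ is an edge iff ($|i_1-i_2|=1$ and $j_1=j_2$) or ($i_1=i_2$ and $|j_1-j_2|=1$). For a graph $G=(V,E)$ and $v\in V$, $N[v]$ denotes the closed neighborhood of $v$. An integer $\{2\}$-dominating function of $G$ is a function $f:V\to\mathbb{Z}_{\ge 0}$ with $\sum_{y\in N[x]} f(y)\ge 2$ for every $x\in V$; the integer $\{2\}$-domination number $\gamma_{\{2\}}(G)$ is the minimum of $\sum_{x\in V} f(x)$ over all integer $\{2\}$-dominating functions $f$ of $G$. -}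

module Defs where

open import Data.Nat using (ℕ; suc; _+_; _≤_; _≟_)
open import Data.Fin using (Fin; toℕ)
open import Data.Product using (_×_; _,_; Σ)
open import Data.Product.Properties using (≡-dec)
open import Data.Sum using (_⊎_)
open import Data.List using (List; map; allFin; concatMap)
open import Data.Nat.ListAction using (sum)
open import Relation.Binary.PropositionalEquality using (_≡_)
open import Relation.Nullary using (Dec; does; _×-dec_; _⊎-dec_)
open import Data.Bool using (if_then_else_)

Vertex : ℕ → ℕ → Set
Vertex m n = Fin m × Fin n

Diff1 : ℕ → ℕ → Set
Diff1 a b = (suc a ≡ b) ⊎ (suc b ≡ a)

diff1? : (a b : ℕ) → Dec (Diff1 a b)
diff1? a b = (suc a ≟ b) ⊎-dec (suc b ≟ a)

Adj : ∀ {m n} → Vertex m n → Vertex m n → Set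
Adj (i₁ , j₁) (i₂ , j₂) =
  (Diff1 (toℕ i₁) (toℕ i₂) × (toℕ j₁ ≡ toℕ j₂)) ⊎
  ((toℕ i₁ ≡ toℕ i₂) × Diff1 (toℕ j₁) (toℕ j₂))

InClosedNbhd : ∀ {m n} → Vertex m n → Vertex m n → Set
InClosedNbhd x y = (x ≡ y) ⊎ Adj x y

inClosedNbhd? : ∀ {m n} (x y : Vertex m n) → Dec (InClosedNbhd x y)
inClosedNbhd? (i₁ , j₁) (i₂ , j₂) =
  ≡-dec Data.Fin._≟_ Data.Fin._≟_ (i₁ , j₁) (i₂ , j₂)
  ⊎-dec (((diff1? (toℕ i₁) (toℕ i₂)) ×-dec (toℕ j₁ ≟ toℕ j₂))
         ⊎-dec ((toℕ i₁ ≟ toℕ i₂) ×-dec (diff1? (toℕ j₁) (toℕ j₂))))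

vertices : (m n : ℕ) → List (Vertex m n)
vertices m n = concatMap (λ i → map (λ j → (i , j)) (allFin n)) (allFin m)

weight : ∀ {m n} → (Vertex m n → ℕ) → ℕ
weight {m} {n} f = sum (map f (vertices m n))

nbhdSum : ∀ {m n} → (Vertex m n → ℕ) → Vertex m n → ℕ
nbhdSum {m} {n} f x =
  sum (map (λ y → if does (inClosedNbhd? x y) then f y else 0) (vertices m n))

Is2DomFun : ∀ {m n} → (Vertex m n → ℕ) → Set
Is2DomFun {m} {n} f = ∀ (x : Vertex m n) → 2 ≤ nbhdSum f x

Int2DomNumberIs : ℕ → ℕ → ℕ → Set
Int2DomNumberIs m n k =
  Σ (Vertex m n → ℕ) (λ f → Is2DomFun f × weight f ≡ k)
  × (∀ (f : Vertex m n → ℕ) → Is2DomFun f → k ≤ weight f)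

{-# OPTIONS --safe #-}
-- Let c k be the total weight of column k. Adding the conditions at the two vertices of column k
-- gives the window inequality c (k-1) + 2 c k + c (k+1) ≥ 4 (with c = 0 outside the grid), and
-- summing the windows telescopes to 4 Σ c ≥ 4n + c 0. So Σ c > n unless c 0 = 0; in that case
-- the first window forces c 1 ≥ 4, and the surplus of the second window again gives Σ c > n.
-- Conversely, weight 1 on both vertices of every even column, plus weight 1 on one vertex of
-- the last column when n is even, is {2}-dominating of weight n + 1.
module Submission where

open import Defs
open import Data.Nat using (ℕ; zero; suc; _+_; _*_; _≤_; _<_; _≡ᵇ_; z≤n; s≤s; s≤s⁻¹)
import Data.Nat as ℕ
open import Data.Nat.Properties
  using ( +-0-commutativeMonoid; module ≤-Reasoning; ≡⇒≡ᵇ; ≤-refl; ≤-reflexive; ≤-trans; n≮n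
        ; n≤1+n; m≤m+n; m≤n+m; m<m+n; m≤n⇒m<n∨m≡n; +-identityʳ; +-comm; +-assoc; +-suc
        ; +-mono-≤; +-monoˡ-≤; +-monoʳ-≤; +-cancelʳ-≤; *-monoʳ-≤; *-cancelˡ-< )
open import Data.Nat.ListAction using (sum)
open import Data.Nat.ListAction.Properties using (sum-++)
open import Data.Nat.Tactic.RingSolver using (solve-∀)
open import Algebra.Properties.CommutativeMonoid.Sum +-0-commutativeMonoid
  using (sum-syntax; sum-cong-≗; ∑-distrib-+; sum-replicate-zero)
open import Data.Fin as Fin using (Fin; zero; suc; toℕ; fromℕ<; opposite)
open import Data.Fin.Properties using (toℕ-injective; toℕ<n; toℕ-fromℕ<)
open import Data.Product using (_,_)
open import Data.Sum using (inj₁; inj₂)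
open import Data.Empty using (⊥-elim)
open import Data.List using (List; map; tabulate; allFin; _++_; [])
open import Data.List.Properties using (map-tabulate; map-++; map-∘; ++-identityʳ)
open import Data.Bool using (true; false; _∨_; if_then_else_)
open import Data.Bool.Properties using (∨-identityʳ; T-≡)
open import Function using (_∘_; id; mk⇔; Equivalence)
open import Relation.Nullary using (does)
open import Relation.Nullary.Decidable using (does-⇔)
open import Relation.Binary.PropositionalEquality

sum-tabulate : ∀ {n} (g : Fin n → ℕ) → sum (tabulate g) ≡ ∑[ j < n ] g j
sum-tabulate {zero}  g = refl
sum-tabulate {suc n} g = cong (g zero +_) (sum-tabulate (g ∘ suc))

sum-map-allFin : ∀ {n} (g : Fin n → ℕ) → sum (map g (allFin n)) ≡ ∑[ j < n ] g j
sum-map-allFin g = trans (cong sum (map-tabulate id g)) (sum-tabulate g)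

∑-select : ∀ n (φ : ℕ → ℕ) a → (n ≤ a → φ a ≡ 0) →
           ∑[ k < n ] (if a ≡ᵇ toℕ k then φ (toℕ k) else 0) ≡ φ a
∑-select zero    φ a       φ-vanishes = sym (φ-vanishes z≤n)
∑-select (suc n) φ zero    _          =
  trans (cong (φ 0 +_) (sum-replicate-zero n)) (+-identityʳ (φ 0))
∑-select (suc n) φ (suc a) φ-vanishes = ∑-select n (φ ∘ suc) a (φ-vanishes ∘ s≤s)

does-toℕ-≟ : ∀ {n} (i j : Fin n) → does (i Fin.≟ j) ≡ (toℕ i ≡ᵇ toℕ j)
does-toℕ-≟ i j = does-⇔ (mk⇔ (cong toℕ) toℕ-injective) (i Fin.≟ j) (toℕ i ℕ.≟ toℕ j)

≡ᵇ-comm : ∀ m n → (m ≡ᵇ n) ≡ (n ≡ᵇ m)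
≡ᵇ-comm m n = does-⇔ (mk⇔ sym sym) (m ℕ.≟ n) (n ℕ.≟ m)

if-adjacent-split : ∀ b k v →
  (if (b ≡ᵇ k) ∨ ((suc b ≡ᵇ k) ∨ (suc k ≡ᵇ b)) then v else 0)
  ≡ (if suc k ≡ᵇ b then v else 0) + (if b ≡ᵇ k then v else 0) + (if suc b ≡ᵇ k then v else 0)
if-adjacent-split zero          zero          v = sym (+-identityʳ v)
if-adjacent-split zero          (suc zero)    v = refl
if-adjacent-split zero          (suc (suc k)) v = refl
if-adjacent-split (suc zero)    zero          v = sym (trans (+-identityʳ (v + 0)) (+-identityʳ v))
if-adjacent-split (suc (suc b)) zero          v = refl
if-adjacent-split (suc b)       (suc k)       v = if-adjacent-split b k v

-- g extended by zeros on both sides and shifted by one, so that g j sits at index 1 + toℕ j and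
-- the path neighbours of j sit at toℕ j, 1 + toℕ j and 2 + toℕ j.
padded : ∀ {n} → (Fin n → ℕ) → ℕ → ℕ
padded         g zero          = 0
padded {zero}  g (suc k)       = 0
padded {suc n} g (suc zero)    = g zero
padded {suc n} g (suc (suc k)) = padded (g ∘ suc) (suc k)

padded-suc-toℕ : ∀ {n} (g : Fin n → ℕ) j → padded g (suc (toℕ j)) ≡ g j
padded-suc-toℕ g zero    = refl
padded-suc-toℕ g (suc j) = padded-suc-toℕ (g ∘ suc) j

padded-∘toℕ : ∀ {n} (h : ℕ → ℕ) k → k < n → padded {n} (h ∘ toℕ) (suc k) ≡ h k
padded-∘toℕ {suc n} h zero    _         = refl
padded-∘toℕ {suc n} h (suc k) (s≤s k<n) = padded-∘toℕ (h ∘ suc) k k<n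

padded-beyond : ∀ {n} (g : Fin n → ℕ) k → n ≤ k → padded g (suc k) ≡ 0
padded-beyond {zero}  g k             _         = refl
padded-beyond {suc n} g (suc k)       (s≤s n≤k) = padded-beyond (g ∘ suc) k n≤k

∑-select-pred : ∀ {n} (g : Fin n → ℕ) b →
  ∑[ k < n ] (if suc (toℕ k) ≡ᵇ b then padded g (suc (toℕ k)) else 0) ≡ padded g b
∑-select-pred {n} g zero    = sum-replicate-zero n
∑-select-pred {n} g (suc b) = trans
  (sum-cong-≗ {n} λ k → cong (λ c → if c then padded g (suc (toℕ k)) else 0) (≡ᵇ-comm (toℕ k) b))
  (∑-select n (padded g ∘ suc) b (padded-beyond g b))

-- The summands of ∑-path-nbhd and ∑-same-index are what nbhdSum reduces to on the row of the
-- vertex and on the other row.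
∑-path-nbhd : ∀ {n} (g : Fin n → ℕ) j → let b = toℕ j in
  ∑[ k < n ] (if does (j Fin.≟ k) ∨ does (diff1? b (toℕ k)) then g k else 0)
  ≡ padded g b + padded g (suc b) + padded g (suc (suc b))
∑-path-nbhd {n} g j = begin
  ∑[ k < n ] (if does (j Fin.≟ k) ∨ does (diff1? b (toℕ k)) then g k else 0)
    ≡⟨ sum-cong-≗ {n} (λ k → cong₂ (λ c v → if c ∨ does (diff1? b (toℕ k)) then v else 0)
                                (does-toℕ-≟ j k) (sym (padded-suc-toℕ g k))) ⟩
  ∑[ k < n ] (if (b ≡ᵇ toℕ k) ∨ does (diff1? b (toℕ k)) then s (suc (toℕ k)) else 0)
    ≡⟨ sum-cong-≗ {n} (λ k → if-adjacent-split b (toℕ k) (s (suc (toℕ k)))) ⟩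
  ∑[ k < n ] (left k + centre k + right k)
    ≡⟨ ∑-distrib-+ (λ k → left k + centre k) right ⟩
  ∑[ k < n ] (left k + centre k) + ∑[ k < n ] right k
    ≡⟨ cong (_+ ∑[ k < n ] right k) (∑-distrib-+ left centre) ⟩
  ∑[ k < n ] left k + ∑[ k < n ] centre k + ∑[ k < n ] right k
    ≡⟨ cong₂ _+_ (cong₂ _+_ (∑-select-pred g b) (∑-select n (s ∘ suc) b (padded-beyond g b)))
                 (∑-select n (s ∘ suc) (suc b) (padded-beyond g (suc b))) ⟩
  s b + s (suc b) + s (suc (suc b)) ∎
  where
  open ≡-Reasoning
  b = toℕ j
  s = padded g
  left centre right : Fin n → ℕ
  left   k = if suc (toℕ k) ≡ᵇ b then s (suc (toℕ k)) else 0
  centre k = if b ≡ᵇ toℕ k then s (suc (toℕ k)) else 0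
  right  k = if suc b ≡ᵇ toℕ k then s (suc (toℕ k)) else 0

∑-same-index : ∀ {n} (g : Fin n → ℕ) (j : Fin n) →
  ∑[ k < n ] (if (toℕ j ≡ᵇ toℕ k) ∨ false then g k else 0) ≡ padded g (suc (toℕ j))
∑-same-index {n} g j = trans
  (sum-cong-≗ {n} λ k → cong₂ (λ c v → if c then v else 0)
                           (∨-identityʳ (toℕ j ≡ᵇ toℕ k)) (sym (padded-suc-toℕ g k)))
  (∑-select n (padded g ∘ suc) (toℕ j) (padded-beyond g (toℕ j)))

sum-vertices₂ : ∀ {n} (φ : Vertex 2 n → ℕ) →
  sum (map φ (vertices 2 n)) ≡ ∑[ j < n ] φ (zero , j) + ∑[ j < n ] φ (suc zero , j)
sum-vertices₂ {n} φ = begin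
  sum (map φ (top ++ (bottom ++ [])))
    ≡⟨ cong (λ xs → sum (map φ (top ++ xs))) (++-identityʳ bottom) ⟩
  sum (map φ (top ++ bottom))
    ≡⟨ cong sum (map-++ φ top bottom) ⟩
  sum (map φ top ++ map φ bottom)
    ≡⟨ sum-++ (map φ top) (map φ bottom) ⟩
  sum (map φ top) + sum (map φ bottom)
    ≡⟨ cong₂ _+_ (sum-row zero) (sum-row (suc zero)) ⟩
  ∑[ j < n ] φ (zero , j) + ∑[ j < n ] φ (suc zero , j) ∎
  where
  open ≡-Reasoning
  top bottom : List (Vertex 2 n)
  top    = map (zero ,_) (allFin n)
  bottom = map (suc zero ,_) (allFin n)
  sum-row : ∀ i → sum (map φ (map (i ,_) (allFin n))) ≡ ∑[ j < n ] φ (i , j)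
  sum-row i = trans (cong sum (sym (map-∘ (allFin n)))) (sum-map-allFin (λ j → φ (i , j)))

module _ {n} (f : Vertex 2 n → ℕ) where

  row : Fin 2 → ℕ → ℕ
  row i = padded (λ j → f (i , j))

  nbhdTerm : Vertex 2 n → Vertex 2 n → ℕ
  nbhdTerm x y = if does (inClosedNbhd? x y) then f y else 0

  nbhdSum-row : ∀ i j → let b = toℕ j in
    nbhdSum f (i , j) ≡ row i b + row i (suc b) + row i (suc (suc b)) + row (opposite i) (suc b)
  nbhdSum-row zero j = trans (sum-vertices₂ (nbhdTerm (zero , j)))
    (cong₂ _+_ (∑-path-nbhd {n} (λ k → f (zero , k)) j) (∑-same-index {n} (λ k → f (suc zero , k)) j))
  nbhdSum-row (suc zero) j = trans (sum-vertices₂ (nbhdTerm (suc zero , j))) (trans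
    (cong₂ _+_ (∑-same-index {n} (λ k → f (zero , k)) j) (∑-path-nbhd {n} (λ k → f (suc zero , k)) j))
    (+-comm (row zero (suc (toℕ j))) _))

Windows≥4 : ℕ → (ℕ → ℕ) → Set
Windows≥4 n s = ∀ k → k < n → 4 ≤ s k + 2 * s (suc k) + s (suc (suc k))

window-telescope : ∀ n (s : ℕ → ℕ) → s (suc n) ≡ 0 → Windows≥4 n s →
  4 * n + s 1 ≤ s 0 + 4 * ∑[ k < n ] s (suc (toℕ k))
window-telescope zero    s s-end _       = subst (_≤ s 0 + 0) (sym s-end) z≤n
window-telescope (suc n) s s-end windows = +-cancelʳ-≤ (s 2) _ _ (begin
  4 * suc n + s 1 + s 2                      ≡⟨ shuffle n (s 1) (s 2) ⟩
  4 * n + s 2 + 4 + s 1                      ≤⟨ +-monoˡ-≤ (s 1) (+-mono-≤ tail-bound (windows 0 (s≤s z≤n))) ⟩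
  s 1 + 4 * T + (s 0 + 2 * s 1 + s 2) + s 1  ≡⟨ collect (s 0) (s 1) (s 2) T ⟩
  s 0 + 4 * (s 1 + T) + s 2                  ∎)
  where
  open ≤-Reasoning
  T = ∑[ k < n ] s (suc (suc (toℕ k)))
  tail-bound : 4 * n + s 2 ≤ s 1 + 4 * T
  tail-bound = window-telescope n (s ∘ suc) s-end (λ k k<n → windows (suc k) (s≤s k<n))
  shuffle : ∀ n a b → 4 * (1 + n) + a + b ≡ 4 * n + b + 4 + a
  shuffle = solve-∀
  collect : ∀ a b c t → b + 4 * t + (a + 2 * b + c) + b ≡ a + 4 * (b + t) + c
  collect = solve-∀

window-sum-exceeds : ∀ n (s : ℕ → ℕ) → 1 ≤ n → s 0 ≡ 0 → s (suc n) ≡ 0 → Windows≥4 n s →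
  n < ∑[ k < n ] s (suc (toℕ k))
window-sum-exceeds n s _ s₀ s-end windows with s 1 in s₁
... | suc _ = *-cancelˡ-< 4 n _ (begin-strict
  4 * n               <⟨ m<m+n (4 * n) (subst (0 <_) (sym s₁) (s≤s z≤n)) ⟩
  4 * n + s 1         ≤⟨ window-telescope n s s-end windows ⟩
  s 0 + 4 * S         ≡⟨ cong (_+ 4 * S) s₀ ⟩
  4 * S               ∎)
  where
  open ≤-Reasoning
  S = ∑[ k < n ] s (suc (toℕ k))
window-sum-exceeds (suc zero) s _ s₀ s-end windows | zero
  with () ← subst (4 ≤_) (trans (cong₂ (λ a b → a + 2 * b + s 2) s₀ s₁) s-end) (windows 0 (s≤s z≤n))
window-sum-exceeds (suc (suc m)) s _ s₀ s-end windows | zero = *-cancelˡ-< 4 _ _ (begin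
  suc (4 * (2 + m))              ≡⟨ expand m ⟩
  9 + 4 * m                      ≤⟨ +-monoˡ-≤ (4 * m) (m≤m+n 9 3) ⟩
  3 * 4 + 4 * m                  ≤⟨ +-mono-≤ (*-monoʳ-≤ 3 s₂≥4) (m≤m+n (4 * m) (s 3)) ⟩
  3 * s 2 + (4 * m + s 3)        ≤⟨ +-monoʳ-≤ (3 * s 2) tail-bound ⟩
  3 * s 2 + (s 2 + 4 * T)        ≡⟨ collect (s 2) T ⟩
  4 * (0 + (s 2 + T))            ≡⟨ cong (λ a → 4 * (a + (s 2 + T))) (sym s₁) ⟩
  4 * (s 1 + (s 2 + T))          ∎)
  where
  open ≤-Reasoning
  T = ∑[ k < m ] s (suc (suc (suc (toℕ k))))
  s₂≥4 : 4 ≤ s 2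
  s₂≥4 = subst (4 ≤_) (cong₂ (λ a b → a + 2 * b + s 2) s₀ s₁) (windows 0 (s≤s z≤n))
  tail-bound : 4 * m + s 3 ≤ s 2 + 4 * T
  tail-bound = window-telescope m (λ k → s (2 + k)) s-end (λ k k<m → windows (2 + k) (s≤s (s≤s k<m)))
  expand : ∀ m → suc (4 * (2 + m)) ≡ 9 + 4 * m
  expand = solve-∀
  collect : ∀ a t → 3 * a + (a + 4 * t) ≡ 4 * (0 + (a + t))
  collect = solve-∀

module _ {n} (f : Vertex 2 n → ℕ) where

  column : ℕ → ℕ
  column k = row f zero k + row f (suc zero) k

  weight≡∑column : weight f ≡ ∑[ k < n ] column (suc (toℕ k))
  weight≡∑column = trans (sum-vertices₂ f) (trans
    (cong₂ _+_ (sum-cong-≗ {n} (sym ∘ padded-suc-toℕ (λ j → f (zero , j))))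
               (sum-cong-≗ {n} (sym ∘ padded-suc-toℕ (λ j → f (suc zero , j)))))
    (sym (∑-distrib-+ {n} (row f zero ∘ suc ∘ toℕ) (row f (suc zero) ∘ suc ∘ toℕ))))

  column-beyond : column (suc n) ≡ 0
  column-beyond = cong₂ _+_ (padded-beyond (λ j → f (zero , j)) n ≤-refl)
                            (padded-beyond (λ j → f (suc zero , j)) n ≤-refl)

  dominating⇒windows≥4 : Is2DomFun f → Windows≥4 n column
  dominating⇒windows≥4 dominating k k<n = begin
    2 + 2
      ≤⟨ +-mono-≤ (dominating (zero , j)) (dominating (suc zero , j)) ⟩
    nbhdSum f (zero , j) + nbhdSum f (suc zero , j)
      ≡⟨ cong₂ _+_ (nbhdSum-row f zero j) (nbhdSum-row f (suc zero) j) ⟩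
    (r₀ b + r₀ (suc b) + r₀ (suc (suc b)) + r₁ (suc b))
      + (r₁ b + r₁ (suc b) + r₁ (suc (suc b)) + r₀ (suc b))
      ≡⟨ regroup (r₀ b) (r₀ (suc b)) (r₀ (suc (suc b))) (r₁ b) (r₁ (suc b)) (r₁ (suc (suc b))) ⟩
    column b + 2 * column (suc b) + column (suc (suc b))
      ≡⟨ cong (λ i → column i + 2 * column (suc i) + column (suc (suc i))) (toℕ-fromℕ< k<n) ⟩
    column k + 2 * column (suc k) + column (suc (suc k)) ∎
    where
    open ≤-Reasoning
    j = fromℕ< k<n
    b = toℕ j
    r₀ r₁ : ℕ → ℕ
    r₀ = row f zero
    r₁ = row f (suc zero)
    regroup : ∀ a₀ b₀ c₀ a₁ b₁ c₁ →
      a₀ + b₀ + c₀ + b₁ + (a₁ + b₁ + c₁ + b₀) ≡ a₀ + a₁ + 2 * (b₀ + b₁) + (c₀ + c₁)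
    regroup = solve-∀

  weight-lower-bound : 1 ≤ n → Is2DomFun f → n + 1 ≤ weight f
  weight-lower-bound 1≤n dominating = subst₂ _≤_ (+-comm 1 n) (sym weight≡∑column)
    (window-sum-exceeds n column 1≤n refl column-beyond (dominating⇒windows≥4 dominating))

alternating : ℕ → ℕ
alternating zero          = 1
alternating (suc zero)    = 0
alternating (suc (suc k)) = alternating k

alternating-+-suc : ∀ k → alternating k + alternating (suc k) ≡ 1
alternating-+-suc zero          = refl
alternating-+-suc (suc zero)    = refl
alternating-+-suc (suc (suc k)) = alternating-+-suc k

∑-alternating : ∀ n → 2 * ∑[ k < n ] alternating (toℕ k) + alternating n ≡ n + 1
∑-alternating zero          = refl
∑-alternating (suc zero)    = refl
∑-alternating (suc (suc n)) =
  trans (peel (∑[ k < n ] alternating (toℕ k)) (alternating n)) (cong (2 +_) (∑-alternating n))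
  where
  peel : ∀ S a → 2 * (1 + (0 + S)) + a ≡ 2 + (2 * S + a)
  peel = solve-∀

alternating-rows-dominate : ∀ m (u v : ℕ → ℕ) →
  (∀ k → k ≤ m → alternating k ≤ u (suc k)) → (∀ k → k ≤ m → alternating k ≤ v (suc k)) →
  suc (alternating m) ≤ u (suc m) + v (suc m) →
  ∀ b → b ≤ m → 2 ≤ u b + u (suc b) + u (suc (suc b)) + v (suc b)
alternating-rows-dominate m u v u≥ v≥ corner zero _ = begin
  alternating 0 + alternating 0  ≤⟨ +-mono-≤ (u≥ 0 z≤n) (v≥ 0 z≤n) ⟩
  u 1 + v 1                      ≤⟨ +-monoˡ-≤ (v 1) (≤-trans (m≤n+m (u 1) (u 0)) (m≤m+n _ (u 2))) ⟩
  u 0 + u 1 + u 2 + v 1          ∎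
  where open ≤-Reasoning
alternating-rows-dominate m u v u≥ v≥ corner (suc c) c<m with m≤n⇒m<n∨m≡n c<m
... | inj₁ 2+c≤m = begin
  2                                              ≡⟨ cong₂ _+_ (alternating-+-suc c) (alternating-+-suc (suc c)) ⟨
  a c + a (1 + c) + (a (1 + c) + a (2 + c))      ≡⟨ swap (a c) (a (1 + c)) (a (2 + c)) ⟩
  a c + a (1 + c) + a (2 + c) + a (1 + c)        ≤⟨ +-mono-≤ (+-mono-≤ (+-mono-≤ left centre) right) other ⟩
  u (1 + c) + u (2 + c) + u (3 + c) + v (2 + c)  ∎
  where
  open ≤-Reasoning
  a = alternating
  left   = u≥ c (≤-trans (n≤1+n c) c<m)
  centre = u≥ (suc c) c<m
  right  = u≥ (suc (suc c)) 2+c≤m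
  other  = v≥ (suc c) c<m
  swap : ∀ x y z → x + y + (y + z) ≡ x + y + z + y
  swap = solve-∀
... | inj₂ refl = begin
  2                                              ≡⟨ cong suc (alternating-+-suc c) ⟨
  suc (a c + a (1 + c))                          ≡⟨ +-suc (a c) (a (1 + c)) ⟨
  a c + suc (a (1 + c))                          ≤⟨ +-mono-≤ (u≥ c (n≤1+n c)) corner ⟩
  u (1 + c) + (u (2 + c) + v (2 + c))            ≡⟨ +-assoc (u (1 + c)) (u (2 + c)) (v (2 + c)) ⟨
  u (1 + c) + u (2 + c) + v (2 + c)              ≤⟨ +-monoˡ-≤ (v (2 + c)) (m≤m+n _ (u (3 + c))) ⟩
  u (1 + c) + u (2 + c) + u (3 + c) + v (2 + c)  ∎
  where
  open ≤-Reasoning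
  a = alternating

topRow : ℕ → ℕ → ℕ
topRow m k = alternating k + (if m ≡ᵇ k then alternating (suc m) else 0)

evenColumns : ∀ m → Vertex 2 (suc m) → ℕ
evenColumns m (zero , j)     = topRow m (toℕ j)
evenColumns m (suc zero , j) = alternating (toℕ j)

evenColumns-weight : ∀ m → weight (evenColumns m) ≡ suc m + 1
evenColumns-weight m = begin
  weight (evenColumns m)               ≡⟨ sum-vertices₂ (evenColumns m) ⟩
  ∑[ j < suc m ] topRow m (toℕ j) + A  ≡⟨ cong (_+ A) (∑-distrib-+ (alternating ∘ toℕ) bonus) ⟩
  A + ∑[ j < suc m ] bonus j + A       ≡⟨ cong (λ x → A + x + A) ∑bonus ⟩
  A + alternating (suc m) + A          ≡⟨ regroup A (alternating (suc m)) ⟩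
  2 * A + alternating (suc m)          ≡⟨ ∑-alternating (suc m) ⟩
  suc m + 1                            ∎
  where
  open ≡-Reasoning
  A = ∑[ j < suc m ] alternating (toℕ j)
  bonus : Fin (suc m) → ℕ
  bonus j = if m ≡ᵇ toℕ j then alternating (suc m) else 0
  ∑bonus : ∑[ j < suc m ] bonus j ≡ alternating (suc m)
  ∑bonus = ∑-select (suc m) (λ _ → alternating (suc m)) m (⊥-elim ∘ n≮n m)
  regroup : ∀ x y → x + y + x ≡ 2 * x + y
  regroup = solve-∀

evenColumns-dominating : ∀ m → Is2DomFun (evenColumns m)
evenColumns-dominating m (i , j) = subst (2 ≤_) (sym (nbhdSum-row f i j))
  (alternating-rows-dominate m (row f i) (row f (opposite i)) (row≥ i) (row≥ (opposite i)) (corner i)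
                             (toℕ j) (s≤s⁻¹ (toℕ<n j)))
  where
  open ≡-Reasoning
  f = evenColumns m
  row≥ : ∀ i k → k ≤ m → alternating k ≤ row f i (suc k)
  row≥ zero       k k≤m =
    subst (alternating k ≤_) (sym (padded-∘toℕ (topRow m) k (s≤s k≤m))) (m≤m+n _ _)
  row≥ (suc zero) k k≤m = ≤-reflexive (sym (padded-∘toℕ alternating k (s≤s k≤m)))
  m≡ᵇm : (m ≡ᵇ m) ≡ true
  m≡ᵇm = Equivalence.to T-≡ (≡⇒≡ᵇ m m refl)
  corner-sum : row f zero (suc m) + row f (suc zero) (suc m) ≡ suc (alternating m)
  corner-sum = begin
    row f zero (suc m) + row f (suc zero) (suc m)
      ≡⟨ cong₂ _+_ (padded-∘toℕ (topRow m) m ≤-refl) (padded-∘toℕ alternating m ≤-refl) ⟩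
    topRow m m + alternating m
      ≡⟨ cong (λ c → alternating m + (if c then alternating (suc m) else 0) + alternating m)
              m≡ᵇm ⟩
    alternating m + alternating (suc m) + alternating m
      ≡⟨ cong (_+ alternating m) (alternating-+-suc m) ⟩
    suc (alternating m) ∎
  corner : ∀ i → suc (alternating m) ≤ row f i (suc m) + row f (opposite i) (suc m)
  corner zero       = ≤-reflexive (sym corner-sum)
  corner (suc zero) = ≤-reflexive (sym (trans (+-comm (row f (suc zero) (suc m)) _) corner-sum))

theorem2p3 : ∀ (n : ℕ) → 1 ≤ n → Int2DomNumberIs 2 n (n + 1)
theorem2p3 (suc m) 1≤n =
  (evenColumns m , evenColumns-dominating m , evenColumns-weight m) ,
  λ f dominating → weight-lower-bound f 1≤n dominating
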